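{- Let $n$ and $m$ be positive integers with $m \geq f(n)$, and write $T_m = 1+2+\cdots+m$. Then \[ \sigma(T_m - n;\ m-1) \geq 2f(n) - 2. \]
   Context: For $A \subseteq \{0,1,2,\ldots\}$, $\partial A = \{z \in A : \{z-1,z+1\} \not\subseteq A\}$, $vol(A)=\sum_{z\in A} z$, $per(A) = \sum_{z \in \partial A} z$, and $A^c = \{0,1,2,\ldots\}\setminus A$. For integers $x \ge 0$, $k\ge 0$: $\sigma(x;k) = \min\{per(A^c) : A \subseteq \{0,\ldots,k\},\ vol(A)=x,\ k\in A\}$, where the minimum over an empty family is $\infty$. Also $f(n) = \lceil (-1+\sqrt{1+8n})/2 \rceil$. -}

module Defs where

open import Data.Nat using (ℕ; zero; suc; _+_; _*_; _∸_; _^_; _≤ᵇ_; _≡ᵇ_)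
open import Data.Bool using (Bool; true; false; if_then_else_; not; _∧_; _∨_)

-- A subset A of ℕ is a Boolean predicate  A : ℕ → Bool  (z ∈ A  iff  A z ≡ true).

sumTo : (ℕ → ℕ) → ℕ → ℕ
sumTo g zero    = g zero
sumTo g (suc N) = g (suc N) + sumTo g N

vol : (ℕ → Bool) → ℕ → ℕ
vol A k = sumTo (λ z → if A z then z else 0) k

inC : (ℕ → Bool) → ℕ → Bool
inC A z = not (A z)

-- z ∈ ∂(A^c)  iff  z ∈ A^c and {z-1, z+1} ⊄ A^c.
-- For z = 0, z-1 = -1 ∉ ℕ, hence -1 ∉ A^c, so the condition holds.
inBdryC : (ℕ → Bool) → ℕ → Bool
inBdryC A zero    = inC A zero
inBdryC A (suc z) = inC A (suc z) ∧ (not (inC A z) ∨ not (inC A (suc (suc z))))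

-- per(A^c) = Σ_{z ∈ ∂(A^c)} z, for A ⊆ {0,…,k}.  Every z ≥ k+2 has z-1, z+1 ∈ A^c,
-- so ∂(A^c) ⊆ {0,…,k+1} and the sum may be taken over z ≤ k+1.
perC : (ℕ → Bool) → ℕ → ℕ
perC A k = sumTo (λ z → if inBdryC A z then z else 0) (suc k)

T : ℕ → ℕ
T zero    = 0
T (suc m) = suc m + T m

-- f(n) = ⌈(-1 + √(1+8n))/2⌉ = least t ∈ ℕ with (-1+√(1+8n))/2 ≤ t,
-- i.e. least t with √(1+8n) ≤ 2t+1, i.e. least t with 1+8n ≤ (2t+1)^2.
-- Searched upward from t = 0; t = n always qualifies, so fuel n+1 suffices.
fSearch : ℕ → ℕ → ℕ → ℕ
fSearch n zero       t = t
fSearch n (suc fuel) t =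
  if suc (8 * n) ≤ᵇ (suc (2 * t)) ^ 2 then t else fSearch n fuel (suc t)

f : ℕ → ℕ
f n = fSearch n (suc n) 0

-- Write k = m − 1 and let A ⊆ {0,…,k} with k ∈ A and vol(A) = T_{k+1} − n.
-- Since k ∈ A and k+1 ∉ A, the point k+1 lies on ∂(A^c), so
-- per(A^c) = (k+1) + P  where P is the sum of the boundary points below k.
-- The missing points C = Σ_{z ≤ k, z ∉ A} z satisfy vol(A) + C = T_k, hence
-- n = (k+1) + C.  Each maximal run of missing points ends at a boundary
-- point b and sums to at most T_b; as T is superadditive this gives the
-- gap bound  C ≤ T_P  (proved by a running invariant along z = 0,1,…,k).
-- Finally f(n) = c+1 with T_c < n (or f(n) = 0), and c ≤ k; the purely
-- arithmetic fact "c ≤ k and T_c < (k+1) + T_P imply 2c ≤ (k+1) + P"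
-- finishes the proof.
module Submission where

open import Defs
open import Data.Nat using (ℕ; _∸_; _*_; _≤_; _<_)
open import Data.Bool using (Bool; true; false)
open import Relation.Binary.PropositionalEquality using (_≡_)

open import Data.Nat using (zero; suc; _+_; _^_; _≤ᵇ_; z≤n; s≤s)
open import Data.Nat.Properties
open import Data.Bool using (if_then_else_; not)
import Data.Bool as Bool
open import Data.Bool.Properties using (∨-zeroʳ)
open import Data.Sum using (_⊎_; inj₁; inj₂)
open import Data.Product using (∃-syntax; _×_; _,_)
open import Relation.Binary.PropositionalEquality
  using (refl; sym; trans; cong; subst; module ≡-Reasoning)
open import Relation.Nullary using (yes; no; contradiction)
open import Data.Empty using (⊥)
open import Data.Nat.Tactic.RingSolver using (solve-∀)

T-mono : ∀ {a b} → a ≤ b → T a ≤ T b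
T-mono {zero}  {_}     z≤n     = z≤n
T-mono {suc a} {suc b} (s≤s p) = +-mono-≤ (s≤s p) (T-mono p)

n≤T : ∀ n → n ≤ T n
n≤T zero    = z≤n
n≤T (suc n) = m≤m+n (suc n) (T n)

-- Adding a number b ≤ c to T a with a < c stays below T c, because
-- T c = c + T (c − 1).  This is the superadditivity step of the gap bound.
T-step : ∀ {a b c} → a < c → b ≤ c → T a + b ≤ T c
T-step {a} {b} {suc c} (s≤s a≤c) b≤c =
  subst (_≤ suc c + T c) (+-comm b (T a)) (+-mono-≤ b≤c (T-mono a≤c))

double-T : ∀ c → 2 * T c ≡ c * suc c
double-T zero    = refl
double-T (suc c) = begin
  2 * (suc c + T c)       ≡⟨ *-distribˡ-+ 2 (suc c) (T c) ⟩
  2 * suc c + 2 * T c     ≡⟨ cong (2 * suc c +_) (double-T c) ⟩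
  2 * suc c + c * suc c   ≡⟨ expand c ⟩
  suc c * suc (suc c)     ∎
  where
  open ≡-Reasoning
  expand : ∀ c → 2 * suc c + c * suc c ≡ suc c * suc (suc c)
  expand = solve-∀

-- (2c+1)² = 1 + 8·T c, linking the definition of f to triangular numbers.
odd-square : ∀ c → suc (2 * c) ^ 2 ≡ suc (8 * T c)
odd-square c = begin
  suc (2 * c) ^ 2            ≡⟨ expand c ⟩
  suc (4 * (c * suc c))      ≡⟨ cong (λ x → suc (4 * x)) (sym (double-T c)) ⟩
  suc (4 * (2 * T c))        ≡⟨ cong suc (sym (*-assoc 4 2 (T c))) ⟩
  suc (8 * T c)              ∎
  where
  open ≡-Reasoning
  expand : ∀ c → suc (2 * c) * (suc (2 * c) * 1) ≡ suc (4 * (c * suc c))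
  expand = solve-∀

sumBelow : (ℕ → ℕ) → ℕ → ℕ
sumBelow g zero    = 0
sumBelow g (suc j) = g j + sumBelow g j

sumTo-top : ∀ g j → sumTo g j ≡ g j + sumBelow g j
sumTo-top g zero    = sym (+-identityʳ (g zero))
sumTo-top g (suc j) = cong (g (suc j) +_) (sumTo-top g j)

term≤sumTo : ∀ g j → g j ≤ sumTo g j
term≤sumTo g zero    = ≤-refl
term≤sumTo g (suc j) = m≤m+n _ _

sumTo-split : ∀ g h → (∀ z → g z + h z ≡ z) → ∀ j → sumTo g j + sumTo h j ≡ T j
sumTo-split g h split zero    = split zero
sumTo-split g h split (suc j) = begin
  g (suc j) + sumTo g j + (h (suc j) + sumTo h j)
    ≡⟨ interchange (g (suc j)) (sumTo g j) (h (suc j)) (sumTo h j) ⟩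
  (g (suc j) + h (suc j)) + (sumTo g j + sumTo h j)
    ≡⟨ cong₂-+ (split (suc j)) (sumTo-split g h split j) ⟩
  suc j + T j ∎
  where
  open ≡-Reasoning
  interchange : ∀ a b c d → a + b + (c + d) ≡ (a + c) + (b + d)
  interchange = solve-∀
  cong₂-+ : ∀ {a b c d} → a ≡ b → c ≡ d → a + c ≡ b + d
  cong₂-+ refl refl = refl

module _ (A : ℕ → Bool) where

  volTerm : ℕ → ℕ
  volTerm z = if A z then z else 0

  gapTerm : ℕ → ℕ
  gapTerm z = if A z then 0 else z

  bdTerm : ℕ → ℕ
  bdTerm z = if inBdryC A z then z else 0

  -- Case analysis on membership that keeps  A z  visible in the goal.
  membership : ∀ z → A z ≡ true ⊎ A z ≡ false
  membership z with A z
  ... | true  = inj₁ refl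
  ... | false = inj₂ refl

  volTerm+gapTerm : ∀ z → volTerm z + gapTerm z ≡ z
  volTerm+gapTerm z with A z
  ... | true  = +-identityʳ z
  ... | false = refl

  gapTerm≤ : ∀ z → gapTerm z ≤ z
  gapTerm≤ z with A z
  ... | true  = z≤n
  ... | false = ≤-refl

  gapTerm-in : ∀ {z} → A z ≡ true → gapTerm z ≡ 0
  gapTerm-in e rewrite e = refl

  gapTerm-out : ∀ {z} → A z ≡ false → gapTerm z ≡ z
  gapTerm-out e rewrite e = refl

  bdTerm-in : ∀ z → A z ≡ true → bdTerm z ≡ 0
  bdTerm-in zero    e rewrite e = refl
  bdTerm-in (suc z) e rewrite e = refl

  gap≤bd : ∀ j → A (suc j) ≡ true → gapTerm j ≤ bdTerm j
  gap≤bd j next with A j in e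
  gap≤bd j next | true  = z≤n
  gap≤bd zero    next | false rewrite e = ≤-refl
  gap≤bd (suc j) next | false rewrite e | next | ∨-zeroʳ (not (not (A j))) = ≤-refl

  -- The running budget at j: boundary points below j, plus j if it is missing
  -- (a run of missing points still open at j will end in a boundary point ≥ j).
  budget : ℕ → ℕ
  budget j = sumBelow bdTerm j + gapTerm j

  gap-bound : ∀ j → sumTo gapTerm j ≤ T (budget j)
  gap-bound zero    = n≤T (gapTerm zero)
  gap-bound (suc j) with membership (suc j)
  ... | inj₁ e = begin
    gapTerm (suc j) + sumTo gapTerm j  ≡⟨ cong (_+ sumTo gapTerm j) (gapTerm-in e) ⟩
    sumTo gapTerm j                    ≤⟨ gap-bound j ⟩
    T (budget j)                       ≤⟨ T-mono budget-grows ⟩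
    T (budget (suc j))                 ∎
    where
    open ≤-Reasoning
    budget-grows : budget j ≤ budget (suc j)
    budget-grows = begin
      sumBelow bdTerm j + gapTerm j            ≤⟨ +-monoʳ-≤ _ (gap≤bd j e) ⟩
      sumBelow bdTerm j + bdTerm j             ≡⟨ +-comm _ (bdTerm j) ⟩
      bdTerm j + sumBelow bdTerm j             ≡⟨ sym (+-identityʳ _) ⟩
      bdTerm j + sumBelow bdTerm j + 0         ≡⟨ cong (bdTerm j + sumBelow bdTerm j +_) (sym (gapTerm-in e)) ⟩
      budget (suc j)                           ∎
  ... | inj₂ e = begin
    gapTerm (suc j) + sumTo gapTerm j  ≡⟨ cong (_+ sumTo gapTerm j) (gapTerm-out e) ⟩
    suc j + sumTo gapTerm j            ≤⟨ +-monoʳ-≤ (suc j) (gap-bound j) ⟩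
    suc j + T (budget j)               ≡⟨ +-comm (suc j) _ ⟩
    T (budget j) + suc j               ≤⟨ T-step budget-grows (m≤n+m (suc j) _) ⟩
    T (bdTerm j + sumBelow bdTerm j + suc j)  ≡⟨ cong (λ x → T (bdTerm j + sumBelow bdTerm j + x)) (sym (gapTerm-out e)) ⟩
    T (budget (suc j))                 ∎
    where
    open ≤-Reasoning
    budget-grows : budget j < bdTerm j + sumBelow bdTerm j + suc j
    budget-grows = begin-strict
      sumBelow bdTerm j + gapTerm j              ≤⟨ +-monoʳ-≤ _ (gapTerm≤ j) ⟩
      sumBelow bdTerm j + j                      <⟨ +-monoʳ-< (sumBelow bdTerm j) (n<1+n j) ⟩
      sumBelow bdTerm j + suc j                  ≤⟨ +-monoˡ-≤ (suc j) (m≤n+m _ (bdTerm j)) ⟩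
      bdTerm j + sumBelow bdTerm j + suc j       ∎

  perimeter-formula : ∀ k → A k ≡ true → A (suc k) ≡ false →
    perC A k ≡ suc k + sumBelow bdTerm k
  perimeter-formula k top above = begin
    bdTerm (suc k) + sumTo bdTerm k              ≡⟨ cong (_+ sumTo bdTerm k) top-on-boundary ⟩
    suc k + sumTo bdTerm k                       ≡⟨ cong (suc k +_) (sumTo-top bdTerm k) ⟩
    suc k + (bdTerm k + sumBelow bdTerm k)       ≡⟨ cong (λ x → suc k + (x + sumBelow bdTerm k)) (bdTerm-in k top) ⟩
    suc k + sumBelow bdTerm k                    ∎
    where
    open ≡-Reasoning
    top-on-boundary : bdTerm (suc k) ≡ suc k
    top-on-boundary rewrite top | above = refl

  n≡top+gaps : ∀ n k → n ≤ T (suc k) → vol A k ≡ T (suc k) ∸ n →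
    n ≡ suc k + sumTo gapTerm k
  n≡top+gaps n k n≤ vol≡ = +-cancelˡ-≡ V n (suc k + C) (begin
    V + n                ≡⟨ cong (_+ n) vol≡ ⟩
    T (suc k) ∸ n + n    ≡⟨ m∸n+n≡m n≤ ⟩
    suc k + T k          ≡⟨ cong (suc k +_) (sym (sumTo-split volTerm gapTerm volTerm+gapTerm k)) ⟩
    suc k + (V + C)      ≡⟨ swap (suc k) V C ⟩
    V + (suc k + C)      ∎)
    where
    open ≡-Reasoning
    V = vol A k
    C = sumTo gapTerm k
    swap : ∀ a b c → a + (b + c) ≡ b + (a + c)
    swap = solve-∀

  n≤perimeter-budget : ∀ n k → A k ≡ true → n ≤ T (suc k) →
    vol A k ≡ T (suc k) ∸ n → n ≤ suc k + T (sumBelow bdTerm k)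
  n≤perimeter-budget n k top n≤ vol≡ = begin
    n                                  ≡⟨ n≡top+gaps n k n≤ vol≡ ⟩
    suc k + sumTo gapTerm k            ≤⟨ +-monoʳ-≤ (suc k) (gap-bound k) ⟩
    suc k + T (budget k)               ≡⟨ cong (λ x → suc k + T (sumBelow bdTerm k + x)) (gapTerm-in top) ⟩
    suc k + T (sumBelow bdTerm k + 0)  ≡⟨ cong (λ x → suc k + T x) (+-identityʳ (sumBelow bdTerm k)) ⟩
    suc k + T (sumBelow bdTerm k)      ∎
    where open ≤-Reasoning

  member≤vol : ∀ k → A k ≡ true → k ≤ vol A k
  member≤vol k top = subst (_≤ vol A k) volTerm-top (term≤sumTo volTerm k)
    where
    volTerm-top : volTerm k ≡ k
    volTerm-top rewrite top = refl

failed-test : ∀ n c → (suc (8 * n) ≤ᵇ suc (2 * c) ^ 2) ≡ false → T c < n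
failed-test n c fails = ≰⇒> λ n≤Tc → reject (≤⇒≤ᵇ (lift n≤Tc))
  where
  lift : n ≤ T c → suc (8 * n) ≤ suc (2 * c) ^ 2
  lift n≤Tc = subst (suc (8 * n) ≤_) (sym (odd-square c)) (s≤s (*-monoʳ-≤ 8 n≤Tc))
  reject : Bool.T (suc (8 * n) ≤ᵇ suc (2 * c) ^ 2) → ⊥
  reject t rewrite fails = t

-- The search either returns its starting point or c+1 after a failed test at c;
-- for f n = fSearch n (n+1) 0 this means f n = 0 or f n = c+1 with T c < n.
fSearch-cases : ∀ n fuel t →
  fSearch n fuel t ≡ t ⊎ ∃[ c ] (fSearch n fuel t ≡ suc c × T c < n)
fSearch-cases n zero       t = inj₁ refl
fSearch-cases n (suc fuel) t with suc (8 * n) ≤ᵇ suc (2 * t) ^ 2 in test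
... | true  = inj₁ refl
... | false with fSearch-cases n fuel (suc t)
...   | inj₁ e = inj₂ (t , e , failed-test n t test)
...   | inj₂ r = inj₂ r

-- If c ≤ k and T c < (k+1) + T P then 2c ≤ (k+1) + P.  Either c ≤ P + 1,
-- or T c ≥ c + (c−1) + T P forces c + (c−1) ≤ k.
double≤ : ∀ c k P → c ≤ k → T c < suc k + T P → c + c ≤ suc k + P
double≤ c k P c≤k T< with c ≤? P
... | yes c≤P = +-mono-≤ (m≤n⇒m≤1+n c≤k) c≤P
double≤ zero k P c≤k T< | no _ = z≤n
double≤ (suc c) k P c≤k T< | no _ with c ≤? P
... | yes c≤P = subst (_≤ suc k + P) (sym (+-suc (suc c) c)) (s≤s (+-mono-≤ c≤k c≤P))
double≤ (suc zero)    k P c≤k T< | no _ | no c≰P = contradiction z≤n c≰P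
double≤ (suc (suc c)) k P c≤k T< | no _ | no c≰P = begin
  suc (suc c) + suc (suc c)   ≡⟨ +-suc (suc (suc c)) (suc c) ⟩
  suc (suc (suc c) + suc c)   ≤⟨ s≤s two-top-terms≤k ⟩
  suc k                       ≤⟨ m≤m+n (suc k) P ⟩
  suc k + P                   ∎
  where
  open ≤-Reasoning
  -- T (c+2) = (c+2) + (c+1) + T c ≥ (c+2) + (c+1) + T P.
  split-T : suc (suc c) + suc c + T P ≤ T (suc (suc c))
  split-T = subst (_≤ T (suc (suc c))) (sym (+-assoc (suc (suc c)) (suc c) (T P)))
              (+-monoʳ-≤ (suc (suc c)) (+-monoʳ-≤ (suc c) (T-mono (≤-pred (≰⇒> c≰P)))))
  two-top-terms≤k : suc (suc c) + suc c ≤ k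
  two-top-terms≤k = ≤-pred (+-cancelʳ-≤ (T P) _ (suc k) (≤-trans (s≤s split-T) T<))

double-pred : ∀ c → 2 * suc c ∸ 2 ≡ c + c
double-pred c = cong (_∸ 2) (expand c)
  where
  expand : ∀ c → 2 * suc c ≡ suc (suc (c + c))
  expand = solve-∀

-- For k ∈ A with vol A k = T (k+1) ∸ n, every c ≤ k with T c < n has
-- 2c ≤ (k+1) + P.  When n > T (k+1) the volume is 0, which forces k = c = 0.
double≤perimeter : ∀ n k (A : ℕ → Bool) c → A k ≡ true → vol A k ≡ T (suc k) ∸ n →
  c ≤ k → T c < n → c + c ≤ suc k + sumBelow (bdTerm A) k
double≤perimeter n k A c top vol≡ c≤k T<n with n ≤? T (suc k)
... | yes n≤ = double≤ c k _ c≤k (<-≤-trans T<n (n≤perimeter-budget A n k top n≤ vol≡))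
... | no n≰ with n≤0⇒n≡0 (≤-trans c≤k (≤-trans (member≤vol A k top) vol≤0))
  where
  vol≤0 : vol A k ≤ 0
  vol≤0 = ≤-reflexive (trans vol≡ (m≤n⇒m∸n≡0 (<⇒≤ (≰⇒> n≰))))
...   | refl = z≤n

lemma15 : (n m : ℕ) → 1 ≤ n → 1 ≤ m → f n ≤ m →
    (A : ℕ → Bool) →
    (∀ z → m ∸ 1 < z → A z ≡ false) →
    A (m ∸ 1) ≡ true →
    vol A (m ∸ 1) ≡ T m ∸ n →
    2 * f n ∸ 2 ≤ perC A (m ∸ 1)
lemma15 n (suc k) _ _ f≤m A outside top vol≡ with fSearch-cases n (suc n) 0
... | inj₁ f≡0 rewrite f≡0 = z≤n
... | inj₂ (c , f≡1+c , T<n) = begin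
  2 * f n ∸ 2                 ≡⟨ cong (λ x → 2 * x ∸ 2) f≡1+c ⟩
  2 * suc c ∸ 2               ≡⟨ double-pred c ⟩
  c + c                       ≤⟨ double≤perimeter n k A c top vol≡ c≤k T<n ⟩
  suc k + sumBelow (bdTerm A) k  ≡⟨ sym (perimeter-formula A k top (outside (suc k) ≤-refl)) ⟩
  perC A k                    ∎
  where
  open ≤-Reasoning
  c≤k : c ≤ k
  c≤k = ≤-pred (subst (_≤ suc k) f≡1+c f≤m)
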